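{- For every square-free word $w\in\{0,1,2\}^*$ with $|w|\ge 2$, we have $\eta(w)\ge |w|/4$.
   Context: A word is square-free if it has no factor $vv$ with $v$ nonempty. A position of $w$ is an integer $p$ with $1\le p<|w|$; write $w=xy$ with $|x|=p$. A nonempty word $u$ is a repetition word of $w$ at $p$ if there are (possibly empty) words $x',y'$ with ($u=x'x$ or $x=x'u$) and ($u=yy'$ or $y=uy'$). $\mathrm{per}(w,p)$ is the minimal length of a repetition word at $p$. An integer $q$ with $1\le q\le |w|$ is a period of $w$ if $w$ is a prefix of $z^n$ for some $n$, where $z$ is the prefix of $w$ of length $q$; $\mathrm{per}(w)$ is the minimal period. A position $p$ is critical if $\mathrm{per}(w,p)=\mathrm{per}(w)$, and $\eta(w)$ denotes the number of critical points of $w$. -}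

module Defs where

open import Data.Nat using (ℕ; _≤_; _<_; _*_)
open import Data.Fin using (Fin)
open import Data.List using (List; []; _++_; length; take; concat; replicate)
open import Data.List.Relation.Unary.All using (All)
open import Data.List.Relation.Unary.Unique.Propositional using (Unique)
open import Data.Product using (Σ; ∃; _×_)
open import Data.Sum using (_⊎_)
open import Relation.Binary.PropositionalEquality using (_≡_; _≢_)

Word : Set
Word = List (Fin 3)

SquareFree : Word → Set
SquareFree w = ∀ (a v b : Word) → w ≡ a ++ v ++ v ++ b → v ≡ []

Position : Word → ℕ → Set
Position w p = 1 ≤ p × p < length w

RepWord : Word → ℕ → Word → Set
RepWord w p u =
  u ≢ [] ×
  Σ Word λ x → Σ Word λ y →
    w ≡ x ++ y × length x ≡ p ×
    ((∃ λ x' → u ≡ x' ++ x) ⊎ (∃ λ x' → x ≡ x' ++ u)) ×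
    ((∃ λ y' → u ≡ y ++ y') ⊎ (∃ λ y' → y ≡ u ++ y'))

LocalPer : Word → ℕ → ℕ → Set
LocalPer w p n =
  (∃ λ u → RepWord w p u × length u ≡ n) ×
  (∀ u → RepWord w p u → n ≤ length u)

IsPeriod : Word → ℕ → Set
IsPeriod w q =
  1 ≤ q × q ≤ length w ×
  ∃ λ k → ∃ λ r → w ++ r ≡ concat (replicate k (take q w))

Per : Word → ℕ → Set
Per w q = IsPeriod w q × (∀ q' → IsPeriod w q' → q ≤ q')

Critical : Word → ℕ → Set
Critical w p = Position w p × ∃ λ n → LocalPer w p n × Per w n

-- η(w) ≥ k  (written 4·η(w) ≥ |w| below) is expressed as: there is a list of
-- k pairwise distinct critical points of w

-- Let q be the least period of w. A position p is critical as soon as no repetition word at p is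
-- shorter than q. For square-free w a short repetition word u at p = |x| (w = x y) must stick out of
-- w on exactly one side: if it is internal on both sides, uu is a factor of w; if it sticks out on
-- both sides, w is a factor of uu and so has the period |u| < q. Let a be the last position with a
-- short repetition sticking out to the left and p the first with one sticking out to the right;
-- all positions strictly between a and p are critical. If there were fewer than |w|/4 of them, the
-- two repetitions would overlap so much that, comparing their lengths l and m, either l ≠ m and w
-- contains a square of length |l - m|, or l = m and l is a period of w shorter than q.

module Submission where

open import Data.Empty using (⊥; ⊥-elim)
open import Data.Fin using (Fin; zero)
open import Data.Fin.Properties using () renaming (_≟_ to _≟ᶠ_)
open import Data.List using (List; []; _∷_; _++_; length; take; drop; concat; replicate; applyUpTo)
open import Data.List.Properties
  using (length-++; length-++-≤ˡ; length-++-≤ʳ; length-++-comm; length-take; length-drop; length-applyUpTo;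
         ++-assoc; ++-identityʳ; take++drop≡id; drop-drop)
open import Data.List.Relation.Unary.All using (All)
open import Data.List.Relation.Unary.All.Properties using (applyUpTo⁺₁)
open import Data.List.Relation.Unary.Unique.Propositional using (Unique)
import Data.List.Relation.Unary.Unique.Propositional.Properties as Unique
open import Data.Nat using (ℕ; zero; suc; _+_; _*_; _∸_; _≤_; _<_; z≤n; s≤s; z<s; s<s; >-nonZero)
open import Data.Nat.Induction using (<-rec)
open import Data.Nat.Properties
open import Algebra.Properties.CommutativeSemigroup +-commutativeSemigroup
  using (x∙yz≈y∙xz; x∙yz≈xz∙y; xy∙z≈x∙zy; xy∙z≈xz∙y)
open import Data.Nat.Tactic.RingSolver using (solve; solve-∀)
open import Data.Product using (Σ; ∃; _×_; _,_; proj₁; proj₂)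
open import Data.Sum using (_⊎_; inj₁; inj₂; [_,_]′)
import Data.Sum as Sum
open import Function using (_∘_; case_of_)
open import Relation.Binary using (tri<; tri≈; tri>)
open import Relation.Binary.PropositionalEquality
open import Relation.Nullary using (¬_; Dec; yes; no; contradiction)
open import Relation.Nullary.Decidable using (map′; _×-dec_)
open import Relation.Unary using (Decidable)

open import Defs

+-<⇒<∸ : ∀ q {j n} → q + j < n → j < n ∸ q
+-<⇒<∸ q {j} {n} q+j<n = m+n≤o⇒m≤o∸n (suc j) (subst (_< n) (+-comm q j) q+j<n)

<∸⇒+-< : ∀ q {j n} → j < n ∸ q → q + j < n
<∸⇒+-< q {j} {n} j<n∸q with q ≤? n
... | yes q≤n = subst (_< n) (+-comm j q) (m≤o∸n⇒m+n≤o (suc j) q≤n j<n∸q)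
... | no  q≰n = contradiction (subst (j <_) (m≤n⇒m∸n≡0 (<⇒≤ (≰⇒> q≰n))) j<n∸q) λ ()

m+[n∸m+o]≡n+o : ∀ {m n o} → m ≤ n → m + (n ∸ m + o) ≡ n + o
m+[n∸m+o]≡n+o {m} {n} {o} m≤n = trans (sym (+-assoc m (n ∸ m) o)) (cong (_+ o) (m+[n∸m]≡n m≤n))

module _ {P : ℕ → Set} (P? : Decidable P) where

  greatest-≤ : P 0 → ∀ n → ∃ λ m → m ≤ n × P m × (∀ {j} → m < j → j ≤ n → ¬ P j)
  greatest-≤ P0 zero = 0 , z≤n , P0 , λ 0<j j≤0 _ → <⇒≱ 0<j j≤0
  greatest-≤ P0 (suc n) with P? (suc n) | greatest-≤ P0 n
  ... | yes P[1+n] | _ = suc n , ≤-refl , P[1+n] , λ 1+n<j j≤1+n _ → <⇒≱ 1+n<j j≤1+n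
  ... | no ¬P[1+n] | m , m≤n , Pm , above = m , m≤n⇒m≤1+n m≤n , Pm , beyond
    where
    beyond : ∀ {j} → m < j → j ≤ suc n → ¬ P j
    beyond {j} m<j j≤1+n with m≤n⇒m<n∨m≡n j≤1+n
    ... | inj₁ j<1+n = above m<j (≤-pred j<1+n)
    ... | inj₂ refl  = ¬P[1+n]

  least-≤ : ∀ n → (∃ λ j → j ≤ n × P j) → ∃ λ m → m ≤ n × P m × (∀ {j} → j < m → ¬ P j)
  least-≤ zero    (j , j≤0 , Pj) = j , j≤0 , Pj , λ i<j → contradiction (<-≤-trans i<j j≤0) λ ()
  least-≤ (suc n) (j , j≤1+n , Pj) with anyUpTo? P? (suc n)
  ... | yes (i , i<1+n , Pi) with least-≤ n (i , ≤-pred i<1+n , Pi)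
  ...   | m , m≤n , Pm , below = m , m≤n⇒m≤1+n m≤n , Pm , below
  least-≤ (suc n) (j , j≤1+n , Pj) | no none =
    j , j≤1+n , Pj , λ {i} i<j Pi → none (i , <-≤-trans i<j j≤1+n , Pi)

-- Reading past the end of a word gives the junk letter 0, so lemmas about `at` carry explicit bounds.
at : Word → ℕ → Fin 3
at []       _       = zero
at (c ∷ w) zero    = c
at (c ∷ w) (suc i) = at w i

at-++ˡ : ∀ u v {i} → i < length u → at (u ++ v) i ≡ at u i
at-++ˡ (c ∷ u) v {zero}  _         = refl
at-++ˡ (c ∷ u) v {suc i} (s<s i<u) = at-++ˡ u v i<u

at-++ʳ : ∀ u v i → at (u ++ v) (length u + i) ≡ at v i
at-++ʳ []      v i = refl
at-++ʳ (c ∷ u) v i = at-++ʳ u v i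

at-take : ∀ k w {i} → i < k → at (take k w) i ≡ at w i
at-take (suc k) []      _         = refl
at-take (suc k) (c ∷ w) {zero}  _         = refl
at-take (suc k) (c ∷ w) {suc i} (s<s i<k) = at-take k w i<k

length-take≤ : ∀ {k} (w : Word) → k ≤ length w → length (take k w) ≡ k
length-take≤ {k} w k≤n = trans (length-take k w) (m≤n⇒m⊓n≡m k≤n)

at-drop : ∀ k w i → at (drop k w) i ≡ at w (k + i)
at-drop zero    w       i = refl
at-drop (suc k) []      i = refl
at-drop (suc k) (c ∷ w) i = at-drop k w i

at-occurrence : ∀ {w} x v {r} → w ≡ x ++ v ++ r → ∀ {i} → i < length v → at w (length x + i) ≡ at v i
at-occurrence x v {r} refl i<v = trans (at-++ʳ x (v ++ r) _) (at-++ˡ v r i<v)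

≡-by-at : ∀ u v → length u ≡ length v → (∀ i → i < length u → at u i ≡ at v i) → u ≡ v
≡-by-at []      []      _ _ = refl
≡-by-at (c ∷ u) (d ∷ v) e f =
  cong₂ _∷_ (f 0 z<s) (≡-by-at u v (suc-injective e) λ i i<u → f (suc i) (s<s i<u))

prefix-by-at : ∀ u v → length u ≤ length v → (∀ i → i < length u → at u i ≡ at v i) →
  ∃ λ r → v ≡ u ++ r
prefix-by-at []      v       _         _ = v , refl
prefix-by-at (c ∷ u) (d ∷ v) (s≤s u≤v) f with prefix-by-at u v u≤v (λ i i<u → f (suc i) (s<s i<u))
... | r , v≡u++r = r , cong₂ _∷_ (sym (f 0 z<s)) v≡u++r

prefix-comparable : ∀ u v → (∀ i → i < length u → i < length v → at u i ≡ at v i) →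
  (∃ λ r → v ≡ u ++ r) ⊎ (∃ λ r → u ≡ v ++ r)
prefix-comparable u v agree with length u ≤? length v
... | yes u≤v = inj₁ (prefix-by-at u v u≤v λ i i<u → agree i i<u (<-≤-trans i<u u≤v))
... | no  u≰v = inj₂ (prefix-by-at v u v≤u λ i i<v → sym (agree i (<-≤-trans i<v v≤u) i<v))
  where v≤u = <⇒≤ (≰⇒> u≰v)

suffix-by-at : ∀ u v → length u ≤ length v →
  (∀ i → i < length u → at v (length v ∸ length u + i) ≡ at u i) → ∃ λ r → v ≡ r ++ u
suffix-by-at u v u≤v f = take k v , trans (sym (take++drop≡id k v)) (cong (take k v ++_) drop≡u)
  where
  k = length v ∸ length u
  |drop| : length (drop k v) ≡ length u
  |drop| = trans (length-drop k v) (m∸[m∸n]≡n u≤v)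
  drop≡u : drop k v ≡ u
  drop≡u = ≡-by-at (drop k v) u |drop| λ i i<d →
    trans (at-drop k v i) (f i (subst (i <_) |drop| i<d))

factor : Word → ℕ → ℕ → Word
factor w i k = take k (drop i w)

length-factor : ∀ w {i k} → i + k ≤ length w → length (factor w i k) ≡ k
length-factor w {i} {k} fits = length-take≤ (drop i w)
  (subst (k ≤_) (sym (length-drop i w)) (m+n≤o⇒m≤o∸n k (subst (_≤ length w) (+-comm i k) fits)))

at-factor : ∀ w i {k r} → r < k → at (factor w i k) r ≡ at w (i + r)
at-factor w i {k} r<k = trans (at-take k (drop i w) r<k) (at-drop i w _)

take++factor++drop : ∀ w i k → w ≡ take i w ++ factor w i k ++ drop (i + k) w
take++factor++drop w i k = begin
  w                                               ≡⟨ sym (take++drop≡id i w) ⟩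
  take i w ++ drop i w                            ≡⟨ cong (take i w ++_) (sym (take++drop≡id k (drop i w))) ⟩
  take i w ++ factor w i k ++ drop k (drop i w)   ≡⟨ cong (take i w ++_) (cong (factor w i k ++_) (drop-drop i k w)) ⟩
  take i w ++ factor w i k ++ drop (i + k) w      ∎
  where open ≡-Reasoning

Match : Word → ℕ → ℕ → ℕ → Set
Match w i j k = ∀ r → r < k → at w (i + r) ≡ at w (j + r)

match? : ∀ w i j k → Dec (Match w i j k)
match? w i j k = map′ (λ m r → m {r}) (λ m {r} → m r) (allUpTo? (λ r → at w (i + r) ≟ᶠ at w (j + r)) k)

match-sym : ∀ {w i j k} → Match w i j k → Match w j i k
match-sym m r r<k = sym (m r r<k)

match-trans : ∀ {w i j l k} → Match w i j k → Match w j l k → Match w i l k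
match-trans m m′ r r<k = trans (m r r<k) (m′ r r<k)

match-shorten : ∀ {w i j k k′} → k′ ≤ k → Match w i j k → Match w i j k′
match-shorten k′≤k m r r<k′ = m r (<-≤-trans r<k′ k′≤k)

match-restrict : ∀ {w i j k} e {k′} → Match w i j k → e + k′ ≤ k → Match w (i + e) (j + e) k′
match-restrict {w} {i} {j} e m e+k′≤k r r<k′ = begin
  at w (i + e + r)    ≡⟨ cong (at w) (+-assoc i e r) ⟩
  at w (i + (e + r))  ≡⟨ m (e + r) (<-≤-trans (+-monoʳ-< e r<k′) e+k′≤k) ⟩
  at w (j + (e + r))  ≡⟨ cong (at w) (sym (+-assoc j e r)) ⟩
  at w (j + e + r)    ∎
  where open ≡-Reasoning

match-++ : ∀ {w i j k k′} → Match w i j k → Match w (i + k) (j + k) k′ → Match w i j (k + k′)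
match-++ {w} {i} {j} {k} m m′ r r<k+k′ with r <? k
... | yes r<k = m r r<k
... | no r≮k with m≤n⇒∃[o]m+o≡n (≮⇒≥ r≮k)
...   | s , refl = begin
  at w (i + (k + s))  ≡⟨ cong (at w) (sym (+-assoc i k s)) ⟩
  at w (i + k + s)    ≡⟨ m′ s (+-cancelˡ-< k s _ r<k+k′) ⟩
  at w (j + k + s)    ≡⟨ cong (at w) (+-assoc j k s) ⟩
  at w (j + (k + s))  ∎
  where open ≡-Reasoning

match-++ˡ : ∀ {u} v {i j k} → i + k ≤ length u → j + k ≤ length u → Match (u ++ v) i j k → Match u i j k
match-++ˡ {u} v {i} {j} i+k≤ j+k≤ m r r<k = begin
  at u (i + r)        ≡⟨ sym (at-++ˡ u v (<-≤-trans (+-monoʳ-< i r<k) i+k≤)) ⟩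
  at (u ++ v) (i + r) ≡⟨ m r r<k ⟩
  at (u ++ v) (j + r) ≡⟨ at-++ˡ u v (<-≤-trans (+-monoʳ-< j r<k) j+k≤) ⟩
  at u (j + r)        ∎
  where open ≡-Reasoning

match-occurrences : ∀ {w} x₁ x₂ v {r₁ r₂} → w ≡ x₁ ++ v ++ r₁ → w ≡ x₂ ++ v ++ r₂ →
  Match w (length x₁) (length x₂) (length v)
match-occurrences x₁ x₂ v w≡₁ w≡₂ i i<v =
  trans (at-occurrence x₁ v w≡₁ i<v) (sym (at-occurrence x₂ v w≡₂ i<v))

factor-≡ : ∀ {w i j k} → i + k ≤ length w → j + k ≤ length w → Match w i j k →
  factor w i k ≡ factor w j k
factor-≡ {w} {i} {j} {k} i-fits j-fits m = ≡-by-at (factor w i k) (factor w j k)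
  (trans (length-factor w {i} i-fits) (sym (length-factor w {j} j-fits))) λ r r<f →
    let r<k = subst (r <_) (length-factor w {i} i-fits) r<f in
    trans (at-factor w i r<k) (trans (m r r<k) (sym (at-factor w j r<k)))

squareFree⇒¬square : ∀ {w} → SquareFree w → ∀ {s d} → 0 < d → s + d + d ≤ length w →
  ¬ Match w s (s + d) d
squareFree⇒¬square {w} sf {s} {d} d>0 fits m =
  <⇒≢ d>0 (sym (trans (sym (length-factor w s+d≤)) (cong length v≡[])))
  where
  s+d≤ : s + d ≤ length w
  s+d≤ = m+n≤o⇒m≤o (s + d) fits
  v = factor w s d
  v≡[] : v ≡ []
  v≡[] = sf (take s w) v (drop (s + d + d) w) (begin
    w                                                           ≡⟨ take++factor++drop w s d ⟩
    take s w ++ v ++ drop (s + d) w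
      ≡⟨ cong (λ z → take s w ++ v ++ z) (sym (take++drop≡id d (drop (s + d) w))) ⟩
    take s w ++ v ++ factor w (s + d) d ++ drop d (drop (s + d) w)
      ≡⟨ cong₂ (λ y z → take s w ++ v ++ y ++ z)
               (sym (factor-≡ {w} {s} {s + d} {d} s+d≤ fits m)) (drop-drop (s + d) d w) ⟩
    take s w ++ v ++ v ++ drop (s + d + d) w  ∎)
    where open ≡-Reasoning

-- Periods

Periodic : Word → ℕ → Set
Periodic w q = Match w 0 q (length w ∸ q)

NoPeriodBelow : Word → ℕ → Set
NoPeriodBelow w q = ∀ {l} → 0 < l → l < q → ¬ Periodic w l

periodic-prefix : ∀ {u} v {q} → q ≤ length u → Periodic (u ++ v) q → Periodic u q
periodic-prefix {u} v {q} q≤u per = match-++ˡ {u} v (m∸n≤m (length u) q) (≤-reflexive (m+[n∸m]≡n q≤u))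
  (match-shorten {u ++ v} (∸-monoˡ-≤ q (length-++-≤ˡ u)) per)

concat-replicate-comm : ∀ (z : Word) k → z ++ concat (replicate k z) ≡ concat (replicate k z) ++ z
concat-replicate-comm z zero    = ++-identityʳ z
concat-replicate-comm z (suc k) = begin
  z ++ z ++ concat (replicate k z)    ≡⟨ cong (z ++_) (concat-replicate-comm z k) ⟩
  z ++ concat (replicate k z) ++ z    ≡⟨ sym (++-assoc z _ z) ⟩
  (z ++ concat (replicate k z)) ++ z  ∎
  where open ≡-Reasoning

length-concat-replicate : ∀ (z : Word) k → length (concat (replicate k z)) ≡ k * length z
length-concat-replicate z zero    = refl
length-concat-replicate z (suc k) = trans (length-++ z) (cong (length z +_) (length-concat-replicate z k))

periodic-concat-replicate : ∀ z k → Periodic (concat (replicate k z)) (length z)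
periodic-concat-replicate z zero r r<0∸z = contradiction (subst (r <_) (0∸n≡0 (length z)) r<0∸z) λ ()
periodic-concat-replicate z (suc k) r r<k = begin
  at (z ++ zᵏ) r            ≡⟨ cong (λ v → at v r) (concat-replicate-comm z k) ⟩
  at (zᵏ ++ z) r            ≡⟨ at-++ˡ zᵏ z r<zᵏ ⟩
  at zᵏ r                   ≡⟨ sym (at-++ʳ z zᵏ r) ⟩
  at (z ++ zᵏ) (length z + r) ∎
  where
  open ≡-Reasoning
  zᵏ = concat (replicate k z)
  r<zᵏ : r < length zᵏ
  r<zᵏ = subst (r <_) (trans (cong (_∸ length z) (length-++ z)) (m+n∸m≡n (length z) _)) r<k

periodic-agree : ∀ {u v q} → 0 < q → Periodic u q → Periodic v q → (∀ i → i < q → at u i ≡ at v i) →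
  ∀ i → i < length u → i < length v → at u i ≡ at v i
periodic-agree {u} {v} {q} q>0 per-u per-v base = <-rec _ step
  where
  step : ∀ i → (∀ {j} → j < i → j < length u → j < length v → at u j ≡ at v j) →
    i < length u → i < length v → at u i ≡ at v i
  step i rec i<u i<v with i <? q
  ... | yes i<q = base i i<q
  ... | no  i≮q with m≤n⇒∃[o]m+o≡n (≮⇒≥ i≮q)
  ...   | j , refl = begin
    at u (q + j)  ≡⟨ sym (per-u j (+-<⇒<∸ q i<u)) ⟩
    at u j        ≡⟨ rec (m<n+m j q>0) (≤-<-trans (m≤n+m j q) i<u) (≤-<-trans (m≤n+m j q) i<v) ⟩
    at v j        ≡⟨ per-v j (+-<⇒<∸ q i<v) ⟩
    at v (q + j)  ∎
    where open ≡-Reasoning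

prefixPower : Word → ℕ → ℕ → Word
prefixPower w q k = concat (replicate k (take q w))

length-prefixPower : ∀ {w q} k → q ≤ length w → length (prefixPower w q k) ≡ k * q
length-prefixPower {w} {q} k q≤n =
  trans (length-concat-replicate (take q w) k) (cong (k *_) (length-take≤ w q≤n))

periodic-prefixPower : ∀ {w q} k → q ≤ length w → Periodic (prefixPower w q k) q
periodic-prefixPower {w} {q} k q≤n =
  subst (Periodic (prefixPower w q k)) (length-take≤ w q≤n) (periodic-concat-replicate (take q w) k)

periodic-extension : ∀ {w q} → 0 < q → q ≤ length w → Periodic w q → ∀ k → length w ≤ k * q →
  ∃ λ r → prefixPower w q k ≡ w ++ r
periodic-extension {w} {q} q>0 q≤n per zero    n≤0 = contradiction (≤-trans q≤n n≤0) (<⇒≱ q>0)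
periodic-extension {w} {q} q>0 q≤n per (suc k) n≤  = prefix-by-at w V n≤V agree
  where
  V = prefixPower w q (suc k)
  n≤V : length w ≤ length V
  n≤V = subst (length w ≤_) (sym (length-prefixPower (suc k) q≤n)) n≤
  agree : ∀ i → i < length w → at w i ≡ at V i
  agree i i<n = periodic-agree {w} {V} q>0 per (periodic-prefixPower (suc k) q≤n)
    prefixes-agree i i<n (<-≤-trans i<n n≤V)
    where
    prefixes-agree : ∀ j → j < q → at w j ≡ at V j
    prefixes-agree j j<q = trans (sym (at-take q w j<q))
      (sym (at-++ˡ (take q w) _ (subst (j <_) (sym (length-take≤ w q≤n)) j<q)))

periodic⇒isPeriod : ∀ {w q} → 0 < q → q ≤ length w → Periodic w q → IsPeriod w q
periodic⇒isPeriod {w} {q} q>0 q≤n per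
  with periodic-extension q>0 q≤n per (length w) (m≤m*n (length w) q {{>-nonZero q>0}})
... | r , wᵏ≡w++r = q>0 , q≤n , length w , r , sym wᵏ≡w++r

isPeriod⇒periodic : ∀ {w q} → IsPeriod w q → Periodic w q
isPeriod⇒periodic {w} {q} (_ , q≤n , k , r , w++r≡wᵏ) =
  periodic-prefix {w} r q≤n (subst (λ v → Periodic v q) (sym w++r≡wᵏ) (periodic-prefixPower k q≤n))

square-factor-offset : ∀ (x′ w y′ u : Word) → x′ ++ w ++ y′ ≡ u ++ u →
  ∀ {r} → length u + r < length w → length x′ + r < length u
square-factor-offset x′ w y′ u e {r} u+r<w = +-cancelʳ-< (length u) (length x′ + r) (length u) (begin-strict
  length x′ + r + length u                 ≡⟨ xy∙z≈x∙zy (length x′) r (length u) ⟩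
  length x′ + (length u + r)               <⟨ +-monoʳ-< (length x′) u+r<w ⟩
  length x′ + length w                     ≤⟨ +-monoʳ-≤ (length x′) (m≤m+n (length w) (length y′)) ⟩
  length x′ + (length w + length y′)       ≡⟨ cong (length x′ +_) (sym (length-++ w)) ⟩
  length x′ + length (w ++ y′)             ≡⟨ sym (length-++ x′) ⟩
  length (x′ ++ w ++ y′)                   ≡⟨ cong length e ⟩
  length (u ++ u)                          ≡⟨ length-++ u ⟩
  length u + length u                      ∎)
  where open ≤-Reasoning

periodic-factor-of-square : ∀ x′ w y′ u → x′ ++ w ++ y′ ≡ u ++ u → Periodic w (length u)
periodic-factor-of-square x′ w y′ u e r r<w∸u = begin
  at w r                                      ≡⟨ sym (at-occurrence x′ w (sym e) r<w) ⟩
  at (u ++ u) (length x′ + r)                 ≡⟨ uu-period (length x′ + r) x′+r<u ⟩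
  at (u ++ u) (length u + (length x′ + r))    ≡⟨ cong (at (u ++ u)) (x∙yz≈y∙xz (length u) (length x′) r) ⟩
  at (u ++ u) (length x′ + (length u + r))    ≡⟨ at-occurrence x′ w (sym e) u+r<w ⟩
  at w (length u + r)                         ∎
  where
  open ≡-Reasoning
  uu-period : Match (u ++ u) 0 (length u) (length u)
  uu-period = match-occurrences [] u u refl (cong (u ++_) (sym (++-identityʳ u)))
  u+r<w : length u + r < length w
  u+r<w = <∸⇒+-< (length u) r<w∸u
  r<w : r < length w
  r<w = ≤-<-trans (m≤n+m r (length u)) u+r<w
  x′+r<u : length x′ + r < length u
  x′+r<u = square-factor-offset x′ w y′ u e {r} u+r<w

squareFree⇒1<period : ∀ {w q} → SquareFree w → 2 ≤ length w → 0 < q → Periodic w q → 1 < q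
squareFree⇒1<period {w} sf 2≤n q>0 per with m≤n⇒m<n∨m≡n q>0
... | inj₁ 1<q = 1<q
... | inj₂ refl = ⊥-elim
  (squareFree⇒¬square sf {0} {1} z<s 2≤n (match-shorten {w} (m+n≤o⇒m≤o∸n 1 2≤n) per))

squareFree-minimal-period : ∀ {w} → SquareFree w → 2 ≤ length w →
  ∃ λ q → 1 < q × q ≤ length w × Periodic w q × NoPeriodBelow w q
squareFree-minimal-period {w} sf 2≤n
  with least-≤ period? (length w) (length w , ≤-refl , <-≤-trans z<s 2≤n , whole)
  where
  period? : Decidable (λ q → 0 < q × Periodic w q)
  period? q = (0 <? q) ×-dec match? w 0 q (length w ∸ q)
  whole : Periodic w (length w)
  whole r r<0 = contradiction (subst (r <_) (n∸n≡0 (length w)) r<0) λ ()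
... | q , q≤n , (q>0 , per) , below =
  q , squareFree⇒1<period sf 2≤n q>0 per , q≤n , per , λ l>0 l<q per-l → below l<q (l>0 , per-l)

minimal-period⇒per : ∀ {w q} → 0 < q → q ≤ length w → Periodic w q → NoPeriodBelow w q → Per w q
minimal-period⇒per q>0 q≤n per noPer =
  periodic⇒isPeriod q>0 q≤n per ,
  λ q′ q′-period → ≮⇒≥ λ q′<q → noPer (proj₁ q′-period) q′<q (isPeriod⇒periodic q′-period)

-- Repetition words

left-context : ∀ w r {p q} → Periodic (w ++ r) q → p ≤ length w → p + q ≤ length (w ++ r) →
  (∃ λ x′ → factor (w ++ r) p q ≡ x′ ++ take p w) ⊎ (∃ λ x′ → take p w ≡ x′ ++ factor (w ++ r) p q)
left-context w r {p} {q} per p≤n fits = Sum.map short long (≤-total p q)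
  where
  V = w ++ r
  x = take p w
  u = factor V p q
  x≡p : length x ≡ p
  x≡p = length-take≤ w p≤n
  u≡q : length u ≡ q
  u≡q = length-factor V {p} {q} fits
  short : p ≤ q → ∃ λ x′ → u ≡ x′ ++ x
  short p≤q = suffix-by-at x u (subst₂ _≤_ (sym x≡p) (sym u≡q) p≤q) λ i i<x → step (subst (i <_) x≡p i<x)
    where
    step : ∀ {i} → i < p → at u (length u ∸ length x + i) ≡ at x i
    step {i} i<p = begin
      at u (length u ∸ length x + i)  ≡⟨ cong (λ k → at u (k + i)) (cong₂ _∸_ u≡q x≡p) ⟩
      at u (q ∸ p + i)                ≡⟨ at-factor V p q∸p+i<q ⟩
      at V (p + (q ∸ p + i))          ≡⟨ cong (at V) (m+[n∸m+o]≡n+o p≤q) ⟩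
      at V (q + i)                    ≡⟨ sym (per i (+-<⇒<∸ q q+i<V)) ⟩
      at V i                          ≡⟨ at-++ˡ w r (<-≤-trans i<p p≤n) ⟩
      at w i                          ≡⟨ sym (at-take p w i<p) ⟩
      at x i                          ∎
      where
      open ≡-Reasoning
      q∸p+i<q : q ∸ p + i < q
      q∸p+i<q = subst (q ∸ p + i <_) (m∸n+n≡m p≤q) (+-monoʳ-< (q ∸ p) i<p)
      q+i<V : q + i < length V
      q+i<V = <-≤-trans (+-monoʳ-< q i<p) (subst (_≤ length V) (+-comm p q) fits)
  long : q ≤ p → ∃ λ x′ → x ≡ x′ ++ u
  long q≤p = suffix-by-at u x (subst₂ _≤_ (sym u≡q) (sym x≡p) q≤p) λ i i<u → step (subst (i <_) u≡q i<u)
    where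
    step : ∀ {i} → i < q → at x (length x ∸ length u + i) ≡ at u i
    step {i} i<q = begin
      at x (length x ∸ length u + i)  ≡⟨ cong (λ k → at x (k + i)) (cong₂ _∸_ x≡p u≡q) ⟩
      at x (p ∸ q + i)                ≡⟨ at-take p w p∸q+i<p ⟩
      at w (p ∸ q + i)                ≡⟨ sym (at-++ˡ w r (<-≤-trans p∸q+i<p p≤n)) ⟩
      at V (p ∸ q + i)                ≡⟨ per (p ∸ q + i) (+-<⇒<∸ q q+[p∸q+i]<V) ⟩
      at V (q + (p ∸ q + i))          ≡⟨ cong (at V) (m+[n∸m+o]≡n+o q≤p) ⟩
      at V (p + i)                    ≡⟨ sym (at-factor V p i<q) ⟩
      at u i                          ∎
      where
      open ≡-Reasoning
      p∸q+i<p : p ∸ q + i < p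
      p∸q+i<p = subst (p ∸ q + i <_) (m∸n+n≡m q≤p) (+-monoʳ-< (p ∸ q) i<q)
      q+[p∸q+i]<V : q + (p ∸ q + i) < length V
      q+[p∸q+i]<V = subst (_< length V) (sym (m+[n∸m+o]≡n+o q≤p)) (<-≤-trans (+-monoʳ-< p i<q) fits)

right-context : ∀ w r {p q} → p + q ≤ length (w ++ r) →
  (∃ λ y′ → factor (w ++ r) p q ≡ drop p w ++ y′) ⊎ (∃ λ y′ → drop p w ≡ factor (w ++ r) p q ++ y′)
right-context w r {p} {q} fits = prefix-comparable (drop p w) (factor (w ++ r) p q) λ j j<y j<u → begin
  at (drop p w) j            ≡⟨ at-drop p w j ⟩
  at w (p + j)               ≡⟨ sym (at-++ˡ w r (<∸⇒+-< p (subst (j <_) (length-drop p w) j<y))) ⟩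
  at (w ++ r) (p + j)        ≡⟨ sym (at-factor (w ++ r) p (subst (j <_) (length-factor (w ++ r) {p} {q} fits) j<u)) ⟩
  at (factor (w ++ r) p q) j ∎
  where open ≡-Reasoning

period⇒repWord : ∀ {w q p} → 0 < q → q ≤ length w → Periodic w q → p ≤ length w →
  ∃ λ u → RepWord w p u × length u ≡ q
period⇒repWord {w} {q} {p} q>0 q≤n per p≤n =
  from-extension (periodic-extension q>0 q≤n per (suc n) (m+n≤o⇒m≤o n n+q≤V))
  where
  n = length w
  n+q≤V : n + q ≤ suc n * q
  n+q≤V = subst (_≤ q + n * q) (+-comm q n) (+-monoʳ-≤ q (m≤m*n n q {{>-nonZero q>0}}))
  from-extension : ∃ (λ r → prefixPower w q (suc n) ≡ w ++ r) → ∃ λ u → RepWord w p u × length u ≡ q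
  from-extension (r , wᵏ≡w++r) = factor (w ++ r) p q ,
    (u≢[] , take p w , drop p w , sym (take++drop≡id p w) , length-take≤ w p≤n ,
     left-context w r per′ p≤n fits , right-context w r fits) , u≡q
    where
    per′ : Periodic (w ++ r) q
    per′ = subst (λ v → Periodic v q) wᵏ≡w++r (periodic-prefixPower (suc n) q≤n)
    fits : p + q ≤ length (w ++ r)
    fits = subst (p + q ≤_) (trans (sym (length-prefixPower (suc n) q≤n)) (cong length wᵏ≡w++r))
      (≤-trans (+-monoˡ-≤ q p≤n) n+q≤V)
    u≡q : length (factor (w ++ r) p q) ≡ q
    u≡q = length-factor (w ++ r) {p} {q} fits
    u≢[] : factor (w ++ r) p q ≢ []
    u≢[] u≡[] = <⇒≢ q>0 (sym (trans (sym u≡q) (cong length u≡[])))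

-- A repetition word u of length l < q at p with x = w[0,p) a proper suffix of u and u a prefix of y:
-- x occurs again at position l.
LeftExternal : Word → ℕ → ℕ → Set
LeftExternal w q p = ∃ λ l → l < q × p < l × l + p ≤ length w × Match w 0 l p

-- Symmetrically, y = w[p,n) is a proper prefix of u and u a suffix of x: y occurs again at p - m.
RightExternal : Word → ℕ → ℕ → Set
RightExternal w q p =
  ∃ λ m → m < q × m ≤ p × p ≤ length w × length w ∸ p < m × Match w (p ∸ m) p (length w ∸ p)

left-external-repWord : ∀ {q} x x′ y′ → SquareFree (x ++ (x′ ++ x) ++ y′) → x′ ++ x ≢ [] →
  length (x′ ++ x) < q → LeftExternal (x ++ (x′ ++ x) ++ y′) q (length x)
left-external-repWord x []         y′ sf x≢[] _   = contradiction (sf [] x y′ refl) x≢[]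
left-external-repWord x x′@(_ ∷ _) y′ sf _    u<q = length (x′ ++ x) , u<q , x<u , fits , match
  where
  x<u : length x < length (x′ ++ x)
  x<u = subst (length x <_) (sym (length-++ x′)) (m<n+m (length x) z<s)
  fits : length (x′ ++ x) + length x ≤ length (x ++ (x′ ++ x) ++ y′)
  fits = subst₂ _≤_ (+-comm (length x) _) (sym (length-++ x))
    (+-monoʳ-≤ (length x) (length-++-≤ˡ (x′ ++ x)))
  match : Match (x ++ (x′ ++ x) ++ y′) 0 (length (x′ ++ x)) (length x)
  match = subst (λ j → Match (x ++ (x′ ++ x) ++ y′) 0 j (length x)) (length-++-comm x x′)
    (match-occurrences [] (x ++ x′) x refl
      (trans (cong (x ++_) (++-assoc x′ x y′)) (sym (++-assoc x x′ (x ++ y′)))))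

right-external-repWord : ∀ {q} x′ y y′ → SquareFree ((x′ ++ y ++ y′) ++ y) → y ++ y′ ≢ [] →
  length (y ++ y′) < q → RightExternal ((x′ ++ y ++ y′) ++ y) q (length (x′ ++ y ++ y′))
right-external-repWord x′ y [] sf y≢[] _ =
  contradiction (sf x′ y [] square) (y≢[] ∘ trans (++-identityʳ y))
  where
  square : (x′ ++ y ++ []) ++ y ≡ x′ ++ y ++ y ++ []
  square = begin
    (x′ ++ y ++ []) ++ y  ≡⟨ cong (λ z → (x′ ++ z) ++ y) (++-identityʳ y) ⟩
    (x′ ++ y) ++ y        ≡⟨ ++-assoc x′ y y ⟩
    x′ ++ y ++ y          ≡⟨ cong (λ z → x′ ++ y ++ z) (sym (++-identityʳ y)) ⟩
    x′ ++ y ++ y ++ []    ∎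
    where open ≡-Reasoning
right-external-repWord x′ y y′@(_ ∷ _) sf _ u<q =
  length u , u<q , length-++-≤ʳ u {x′} , length-++-≤ˡ (x′ ++ u) , n∸p<u ,
  subst₂ (λ i k → Match w i p k) p∸u≡x′ n∸p≡y match
  where
  u = y ++ y′
  w = (x′ ++ u) ++ y
  p = length (x′ ++ u)
  n∸p≡y : length y ≡ length w ∸ p
  n∸p≡y = sym (trans (cong (_∸ p) (length-++ (x′ ++ u))) (m+n∸m≡n p (length y)))
  p∸u≡x′ : length x′ ≡ p ∸ length u
  p∸u≡x′ = sym (trans (cong (_∸ length u) (length-++ x′)) (m+n∸n≡m (length x′) (length u)))
  n∸p<u : length w ∸ p < length u
  n∸p<u = subst₂ _<_ n∸p≡y (sym (length-++ y)) (m<m+n (length y) z<s)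
  match : Match w (length x′) p (length y)
  match = match-occurrences x′ (x′ ++ u) y (trans (++-assoc x′ u y) (cong (x′ ++_) (++-assoc y y′ y)))
    (cong ((x′ ++ u) ++_) (sym (++-identityʳ y)))

≢[]⇒0<length : ∀ {u : Word} → u ≢ [] → 0 < length u
≢[]⇒0<length {[]}    u≢[] = contradiction refl u≢[]
≢[]⇒0<length {_ ∷ _} _    = z<s

short-repWord⇒external : ∀ {w q p u} → SquareFree w → NoPeriodBelow w q → RepWord w p u → length u < q →
  LeftExternal w q p ⊎ RightExternal w q p
short-repWord⇒external sf _ (u≢[] , _ , _ , refl , refl , inj₂ (x′ , refl) , inj₂ (y′ , refl)) _ =
  contradiction (sf x′ _ y′ (++-assoc x′ _ _)) u≢[]
short-repWord⇒external sf _ (u≢[] , x , _ , refl , refl , inj₁ (x′ , refl) , inj₂ (y′ , refl)) u<q =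
  inj₁ (left-external-repWord x x′ y′ sf u≢[] u<q)
short-repWord⇒external sf _ (u≢[] , _ , y , refl , refl , inj₂ (x′ , refl) , inj₁ (y′ , refl)) u<q =
  inj₂ (right-external-repWord x′ y y′ sf u≢[] u<q)
short-repWord⇒external _ noPer (u≢[] , x , y , refl , refl , inj₁ (x′ , refl) , inj₁ (y′ , u≡yy′)) u<q =
  contradiction (periodic-factor-of-square x′ (x ++ y) y′ (x′ ++ x) x′wy′≡uu)
    (noPer (≢[]⇒0<length u≢[]) u<q)
  where
  x′wy′≡uu : x′ ++ (x ++ y) ++ y′ ≡ (x′ ++ x) ++ (x′ ++ x)
  x′wy′≡uu = begin
    x′ ++ (x ++ y) ++ y′    ≡⟨ cong (x′ ++_) (++-assoc x y y′) ⟩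
    x′ ++ x ++ y ++ y′      ≡⟨ sym (++-assoc x′ x (y ++ y′)) ⟩
    (x′ ++ x) ++ y ++ y′    ≡⟨ cong ((x′ ++ x) ++_) (sym u≡yy′) ⟩
    (x′ ++ x) ++ (x′ ++ x)  ∎
    where open ≡-Reasoning

no-external⇒critical : ∀ {w q p} → SquareFree w → 0 < q → q ≤ length w → Periodic w q → NoPeriodBelow w q →
  Position w p → ¬ LeftExternal w q p → ¬ RightExternal w q p → Critical w p
no-external⇒critical sf q>0 q≤n per noPer pos ¬left ¬right = pos , _ ,
  (period⇒repWord q>0 q≤n per (<⇒≤ (proj₂ pos)) ,
   λ u rep → ≮⇒≥ λ u<q → [ ¬left , ¬right ]′ (short-repWord⇒external sf noPer rep u<q)) ,
  minimal-period⇒per q>0 q≤n per noPer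

-- Short external repetitions lie far apart

excess-absurd : ∀ {L R} k → L ≤ R → L ≡ suc R + k → ⊥
excess-absurd k L≤R refl = <-irrefl refl (≤-trans (m≤m+n _ k) L≤R)

-- a and p are the positions of a short left and a short right external repetition, of lengths l
-- and m, n = p + b is the length of w, and `few` says that fewer than n/4 positions lie strictly
-- between a and p. Each bound is refuted by a sum of hypotheses whose sides differ by a constant.
module ShortGap {a l m p b : ℕ} (a<l : a < l) (l+a≤n : l + a ≤ p + b) (b<m : b < m) (m≤p : m ≤ p)
                (few : 4 * p < p + b + 4 * suc a) where

  p≤2a+1 : p ≤ suc (a + a)
  p≤2a+1 = ≮⇒≥ absurd
    where
    absurd : suc (a + a) < p → ⊥
    absurd 2a+1<p = excess-absurd 1 (+-mono-≤ (+-mono-≤ 2a+1<p 2a+1<p) (+-mono-≤ (≤-trans b<m m≤p) few))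
      (solve (a ∷ b ∷ p ∷ []))

  2a<n : a + a < p + b
  2a<n = ≤-trans (+-monoˡ-≤ a a<l) l+a≤n

  p≤a+b+1 : p ≤ suc (a + b)
  p≤a+b+1 = ≮⇒≥ absurd
    where
    absurd : suc (a + b) < p → ⊥
    absurd a+b+1<p = excess-absurd 1 (+-mono-≤ (+-mono-≤ a+b+1<p a+b+1<p) (+-mono-≤ 2a<n few))
      (solve (a ∷ b ∷ p ∷ []))

  p≤a+l : p ≤ a + l
  p≤a+l = ≤-trans p≤2a+1 (subst (_≤ a + l) (+-suc a a) (+-monoʳ-≤ a a<l))

  m≤l+b : m ≤ l + b
  m≤l+b = ≤-trans m≤p (≤-trans p≤a+b+1 (+-monoˡ-≤ b a<l))

  p≤a+m : p ≤ a + m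
  p≤a+m = ≤-trans p≤a+b+1 (subst (_≤ a + m) (+-suc a b) (+-monoʳ-≤ a b<m))

  l≤a+m : l ≤ a + m
  l≤a+m = +-cancelʳ-≤ a l (a + m) (begin
    l + a           ≤⟨ l+a≤n ⟩
    p + b           ≤⟨ +-monoˡ-≤ b p≤2a+1 ⟩
    suc (a + a) + b ≡⟨ solve (a ∷ b ∷ []) ⟩
    a + suc b + a   ≤⟨ +-monoˡ-≤ a (+-monoʳ-≤ a b<m) ⟩
    a + m + a       ∎)
    where open ≤-Reasoning

square-from-shorter-left : ∀ {w a l t d b} → Match w 0 l a → Match w t (t + (l + d)) b →
  t + d ≤ a → d ≤ b → Match w (t + l) (t + l + d) d
square-from-shorter-left {w} {a} {l} {t} {d} left right t+d≤a d≤b =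
  subst₂ (λ i j → Match w i j d) (+-comm l t) (sym (+-assoc t l d))
    (match-trans {w} (match-sym {w} (match-restrict {w} t left t+d≤a)) (match-shorten {w} d≤b right))

square-from-longer-left : ∀ {w a m d t b s f} → Match w 0 (m + d) a → Match w t (t + m) b →
  s + d ≡ a → t + f ≡ a → f + d ≤ b → Match w s (s + d) d
square-from-longer-left {w} {a} {m} {d} {t} {b} {s} {f} left right s+d≡a t+f≡a f+d≤b =
  subst (λ j → Match w s j d) t+f≡s+d
    (match-trans {w} (subst (λ j → Match w s j d) m+d+s≡t+m+f (match-restrict {w} s left (≤-reflexive s+d≡a)))
      (match-sym {w} (match-restrict {w} f right f+d≤b)))
  where
  t+f≡s+d : t + f ≡ s + d
  t+f≡s+d = trans t+f≡a (sym s+d≡a)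
  m+d+s≡t+m+f : m + d + s ≡ t + m + f
  m+d+s≡t+m+f = begin
    m + d + s    ≡⟨ solve (m ∷ d ∷ s ∷ []) ⟩
    m + (s + d)  ≡⟨ cong (m +_) (sym t+f≡s+d) ⟩
    m + (t + f)  ≡⟨ solve (m ∷ t ∷ f ∷ []) ⟩
    t + m + f    ∎
    where open ≡-Reasoning

period-from-equal : ∀ {w a l t b} → Match w 0 l a → Match w t (t + l) b → t ≤ a → Match w 0 l (t + b)
period-from-equal {w} {a} {l} {t} {b} left right t≤a =
  match-++ {w} (match-shorten {w} t≤a left) (subst (λ j → Match w t j b) (+-comm t l) right)

shorter-left-absurd : ∀ {w a l t m b} → SquareFree w → Match w 0 l a → Match w t (t + m) b →
  l < m → t + m ≤ a + l → m ≤ l + b → t + m + b ≡ length w → ⊥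
shorter-left-absurd {w} {a} {l} {t} {m} {b} sf left right l<m p≤a+l m≤l+b t+m+b≡n =
  squareFree⇒¬square sf (m<n⇒0<n∸m l<m) fits (square-from-shorter-left {w} left right′ t+d≤a d≤b)
  where
  d = m ∸ l
  l+d≡m : l + d ≡ m
  l+d≡m = m+[n∸m]≡n (<⇒≤ l<m)
  right′ : Match w t (t + (l + d)) b
  right′ = subst (λ j → Match w t (t + j) b) (sym l+d≡m) right
  t+d≤a : t + d ≤ a
  t+d≤a = +-cancelʳ-≤ l (t + d) a
    (subst (_≤ a + l) (trans (cong (t +_) (sym l+d≡m)) (x∙yz≈xz∙y t l d)) p≤a+l)
  d≤b : d ≤ b
  d≤b = +-cancelˡ-≤ l d b (subst (_≤ l + b) (sym l+d≡m) m≤l+b)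
  fits : t + l + d + d ≤ length w
  fits = subst₂ _≤_ (cong (_+ d) (trans (cong (t +_) (sym l+d≡m)) (sym (+-assoc t l d)))) t+m+b≡n
    (+-monoʳ-≤ (t + m) d≤b)

equal-left-absurd : ∀ {w q a l t m b} → NoPeriodBelow w q → 0 < l → l < q →
  Match w 0 l a → Match w t (t + m) b → l ≡ m → t + m ≤ a + l → t + m + b ≡ length w → ⊥
equal-left-absurd {w} {q} {a} {l} {t} {m} {b} noPer l>0 l<q left right refl p≤a+l t+l+b≡n =
  noPer l>0 l<q (subst (Match w 0 l) t+b≡n∸l (period-from-equal {w} left right (+-cancelʳ-≤ l t a p≤a+l)))
  where
  t+b≡n∸l : t + b ≡ length w ∸ l
  t+b≡n∸l = sym (trans (cong (_∸ l) (trans (sym t+l+b≡n) (xy∙z≈xz∙y t l b))) (m+n∸n≡m (t + b) l))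

longer-left-absurd : ∀ {w a l t m b} → SquareFree w → Match w 0 l a → Match w t (t + m) b →
  m < l → t + m ≤ a + m → l ≤ a + m → l + a ≤ length w → t + m + b ≡ length w → ⊥
longer-left-absurd {w} {a} {l} {t} {m} {b} sf left right m<l p≤a+m l≤a+m l+a≤n t+m+b≡n =
  squareFree⇒¬square sf (m<n⇒0<n∸m m<l) fits (square-from-longer-left {w} left′ right s+d≡a t+f≡a f+d≤b)
  where
  d = l ∸ m
  m+d≡l : m + d ≡ l
  m+d≡l = m+[n∸m]≡n (<⇒≤ m<l)
  left′ : Match w 0 (m + d) a
  left′ = subst (λ j → Match w 0 j a) (sym m+d≡l) left
  d≤a : d ≤ a
  d≤a = +-cancelˡ-≤ m d a (subst₂ _≤_ (sym m+d≡l) (+-comm a m) l≤a+m)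
  t≤a : t ≤ a
  t≤a = +-cancelʳ-≤ m t a p≤a+m
  s = a ∸ d
  s+d≡a : s + d ≡ a
  s+d≡a = m∸n+n≡m d≤a
  f = a ∸ t
  t+f≡a : t + f ≡ a
  t+f≡a = m+[n∸m]≡n t≤a
  f+d≤b : f + d ≤ b
  f+d≤b = +-cancelˡ-≤ (t + m) (f + d) b (subst₂ _≤_ l+a≡ (sym t+m+b≡n) l+a≤n)
    where
    rearrange : ∀ m d t f → m + d + (t + f) ≡ t + m + (f + d)
    rearrange = solve-∀
    l+a≡ : l + a ≡ t + m + (f + d)
    l+a≡ = trans (cong₂ _+_ (sym m+d≡l) (sym t+f≡a)) (rearrange m d t f)
  fits : s + d + d ≤ length w
  fits = begin
    s + d + d  ≡⟨ cong (_+ d) s+d≡a ⟩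
    a + d      ≤⟨ +-monoʳ-≤ a (subst (d ≤_) m+d≡l (m≤n+m d m)) ⟩
    a + l      ≡⟨ +-comm a l ⟩
    l + a      ≤⟨ l+a≤n ⟩
    length w   ∎
    where open ≤-Reasoning

matches-far-apart : ∀ {w q} → SquareFree w → NoPeriodBelow w q → ∀ {a l t m b} → t + m + b ≡ length w →
  a < l → l + a ≤ length w → l < q → Match w 0 l a → b < m → Match w t (t + m) b →
  length w + 4 * suc a ≤ 4 * (t + m)
matches-far-apart {w} sf noPer {a} {l} {t} {m} {b} t+m+b≡n a<l l+a≤n l<q left b<m right = ≮⇒≥ λ few →
  let open ShortGap a<l (subst (l + a ≤_) (sym t+m+b≡n) l+a≤n) b<m (m≤n+m m t)
                    (subst (λ n → 4 * (t + m) < n + 4 * suc a) (sym t+m+b≡n) few)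
  in case <-cmp l m of λ where
    (tri< l<m _ _) → shorter-left-absurd {w} sf left right l<m p≤a+l m≤l+b t+m+b≡n
    (tri≈ _ l≡m _) → equal-left-absurd {w} noPer (≤-<-trans z≤n a<l) l<q left right l≡m p≤a+l t+m+b≡n
    (tri> _ _ m<l) → longer-left-absurd {w} sf left right m<l p≤a+m l≤a+m l+a≤n t+m+b≡n

externals-far-apart : ∀ {w q a p} → SquareFree w → NoPeriodBelow w q →
  LeftExternal w q a → RightExternal w q p → length w + 4 * suc a ≤ 4 * p
externals-far-apart {w} {q} {a} {p} sf noPer (l , l<q , a<l , l+a≤n , left) (m , _ , m≤p , p≤n , n∸p<m , right) =
  subst (λ k → length w + 4 * suc a ≤ 4 * k) t+m≡p
    (matches-far-apart sf noPer t+m+b≡n a<l l+a≤n l<q left n∸p<m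
      (subst (λ k → Match w (p ∸ m) k (length w ∸ p)) (sym t+m≡p) right))
  where
  t+m≡p : p ∸ m + m ≡ p
  t+m≡p = m∸n+n≡m m≤p
  t+m+b≡n : p ∸ m + m + (length w ∸ p) ≡ length w
  t+m+b≡n = trans (cong (_+ (length w ∸ p)) t+m≡p) (m+[n∸m]≡n p≤n)

-- Counting critical points

leftExternal? : ∀ w q → Decidable (LeftExternal w q)
leftExternal? w q p = anyUpTo? (λ l → (p <? l) ×-dec (l + p ≤? length w) ×-dec match? w 0 l p) q

rightExternal? : ∀ w q → Decidable (RightExternal w q)
rightExternal? w q p = anyUpTo? (λ m → (m ≤? p) ×-dec (p ≤? length w) ×-dec (length w ∸ p <? m) ×-dec
  match? w (p ∸ m) p (length w ∸ p)) q

leftExternal-start : ∀ {w q} → 1 < q → q ≤ length w → LeftExternal w q 0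
leftExternal-start 1<q q≤n = 1 , 1<q , z<s , ≤-trans (<⇒≤ 1<q) q≤n , λ _ ()

rightExternal-end : ∀ {w q} → 1 < q → q ≤ length w → RightExternal w q (length w)
rightExternal-end {w} 1<q q≤n =
  1 , 1<q , ≤-trans (<⇒≤ 1<q) q≤n , ≤-refl , subst (_< 1) (sym (n∸n≡0 (length w))) z<s ,
  λ r r<0 → contradiction (subst (r <_) (n∸n≡0 (length w)) r<0) λ ()

between : ℕ → ℕ → List ℕ
between a p = applyUpTo (suc a +_) (p ∸ suc a)

length-between : ∀ a p → length (between a p) ≡ p ∸ suc a
length-between a p = length-applyUpTo (suc a +_) (p ∸ suc a)

unique-between : ∀ a p → Unique (between a p)
unique-between a p =
  Unique.applyUpTo⁺₁ (suc a +_) (p ∸ suc a) λ i<j _ → <⇒≢ i<j ∘ +-cancelˡ-≡ (suc a) _ _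

all-between : ∀ {P : ℕ → Set} a p → (∀ {j} → a < j → j < p → P j) → All P (between a p)
all-between a p inside = applyUpTo⁺₁ (suc a +_) (p ∸ suc a) λ {i} i<k →
  inside (m≤m+n (suc a) i) (<∸⇒+-< (suc a) i<k)

quarter≤length-between : ∀ {n} a p → n + 4 * suc a ≤ 4 * p → n ≤ 4 * length (between a p)
quarter≤length-between {n} a p far = subst (n ≤_) 4*[p∸a∸1]≡ (m+n≤o⇒m≤o∸n n far)
  where
  4*[p∸a∸1]≡ : 4 * p ∸ 4 * suc a ≡ 4 * length (between a p)
  4*[p∸a∸1]≡ = trans (sym (*-distribˡ-∸ 4 p (suc a))) (cong (4 *_) (sym (length-between a p)))

mainTheorem9 : (w : Word) → SquareFree w → 2 ≤ length w →
    Σ (List ℕ) λ S → Unique S × All (Critical w) S × length w ≤ 4 * length S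
mainTheorem9 w sf 2≤n with squareFree-minimal-period sf 2≤n
... | q , 1<q , q≤n , per , noPer
  with greatest-≤ (leftExternal? w q) (leftExternal-start {w} 1<q q≤n) (length w)
     | least-≤ (rightExternal? w q) (length w) (length w , ≤-refl , rightExternal-end {w} 1<q q≤n)
... | a , _ , left , ¬left | p , p≤n , right , ¬right =
  between a p , unique-between a p ,
  all-between a p (λ a<j j<p → no-external⇒critical sf (<⇒≤ 1<q) q≤n per noPer
    (<-≤-trans z<s a<j , <-≤-trans j<p p≤n) (¬left a<j (<⇒≤ (<-≤-trans j<p p≤n))) (¬right j<p)) ,
  quarter≤length-between a p (externals-far-apart sf noPer left right)
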